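{- Let $\mathfrak F=(X,R,E)$ be an $\mathbf{MK}$-frame. For every $\mathcal{L}_\exists$-formula $\varphi$, $\varphi$ is valid in $\mathfrak F$ if and only if $\varphi^t$ is valid in the Kripke bundle $\mathscr B(\mathfrak F)$.
   Context: An $\mathbf{MK}$-frame is $(X,R,E)$, $X\neq\varnothing$, $R\subseteq X^2$, $E$ an equivalence relation, with $x\mathrel Ey$, $y\mathrel Rz$ implying $x\mathrel Ru$, $u\mathrel Ez$ for some $u$. $\mathcal{L}_\exists$-formulas (letters, $\neg,\vee,\Diamond,\exists$) are evaluated in $\mathfrak F$ with $\Diamond$ via $R$ and $\exists$ via $E$; valid means true at all points under all valuations. The translation $(-)^t$ into first-order modal logic fixes a variable $x$ and unary predicates $p^*$: $p^t=p^*(x)$, commutes with $\neg,\vee,\Diamond$, $(\exists\varphi)^t=\exists x\varphi^t$. $\mathscr B(\mathfrak F)$ is the Kripke bundle $((X,R),\pi,(X/E,R_0))$ with $\pi$ the quotient map and $[x]\mathrel{R_0}[y]$ iff $x\mathrel Rz$ and $z\mathrel Ey$ for some $z$. A valuation $I$ on a bundle $((X,R),\pi,(X_0,R_0))$ assigns to each $m$-ary predicate $P$ and $w\in X_0$ a set $I_w(P)\subseteq(\pi^{ -1}(w))^m$; at $w$, sentences with constants from $\pi^{ -1}(w)$ are evaluated by: $w\models P(\vec a)$ iff $\vec a\in I_w(P)$; Boolean clauses classical; $w\models\exists x\psi$ iff $w\models\psi[a/x]$ for some $a\in\pi^{ -1}(w)$; $w\models\Diamond\psi[\vec a/\vec x]$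 iff there are $v\in R_0[w]$ and $b_i\in R[a_i]\cap\pi^{ -1}(v)$ with $a_i=a_j\Rightarrow b_i=b_j$ such that $v\models\psi[\vec b/\vec x]$. A formula is valid in the bundle if its universal closure holds at every $w\in X_0$ under every valuation. -}

module Defs where

open import Data.Nat using (ℕ; zero; suc; _≟_)
open import Data.Fin using (Fin)
open import Data.Product using (Σ; _×_; _,_)
open import Data.Sum using (_⊎_)
open import Relation.Nullary using (¬_; yes; no)
open import Relation.Binary.PropositionalEquality using (_≡_; _≢_)
open import Relation.Binary.Structures using (IsEquivalence)

record MKFrame : Set₁ where
  field
    X       : Set
    R       : X → X → Set
    E       : X → X → Set
    E-equiv : IsEquivalence E
    point   : X
    mk      : ∀ {x y z} → E x y → R y z → Σ X (λ u → R x u × E u z)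

data Form : Set where
  var : ℕ → Form
  neg : Form → Form
  or  : Form → Form → Form
  dia : Form → Form
  ex  : Form → Form

module _ (F : MKFrame) where
  open MKFrame F

  Val : Set₁
  Val = ℕ → X → Set

  sat : Val → X → Form → Set
  sat V x (var n)  = V n x
  sat V x (neg φ)  = ¬ sat V x φ
  sat V x (or φ ψ) = sat V x φ ⊎ sat V x ψ
  sat V x (dia φ)  = Σ X (λ y → R x y × sat V y φ)
  sat V x (ex φ)   = Σ X (λ y → E x y × sat V y φ)

  ValidF : Form → Set₁
  ValidF φ = (V : Val) → (x : X) → sat V x φ

-- First-order modal language: variables ℕ, predicate symbols P^m_k
-- (m = arity, k ∈ ℕ), ¬, ∨, ◇, ∃.

data FForm : Set where
  atom : (m : ℕ) → (k : ℕ) → (Fin m → ℕ) → FForm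
  fneg : FForm → FForm
  for  : FForm → FForm → FForm
  fdia : FForm → FForm
  fex  : ℕ → FForm → FForm

Free : ℕ → FForm → Set
Free y (atom m k xs) = Σ (Fin m) (λ i → xs i ≡ y)
Free y (fneg ψ)      = Free y ψ
Free y (for ψ χ)     = Free y ψ ⊎ Free y χ
Free y (fdia ψ)      = Free y ψ
Free y (fex z ψ)     = (y ≢ z) × Free y ψ

upd : {A : Set} → (ℕ → A) → ℕ → A → ℕ → A
upd g z a y with y ≟ z
... | yes _ = a
... | no  _ = g y

-- Since Agda has no quotient
-- types, the base is given as a set B together with an equivalence ≈
-- (its equality); π⁻¹(w) = { a | π a ≈ w }, and valuations must respect ≈.

record Bundle : Set₁ where
  field
    T     : Set
    Rt    : T → T → Set
    B     : Set
    _≈_   : B → B → Set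
    ≈-eq  : IsEquivalence _≈_
    R₀    : B → B → Set
    π     : T → B

module _ (𝔅 : Bundle) where
  open Bundle 𝔅

  -- a valuation: I w P^m_k ⊆ (π⁻¹ w)^m ; values on tuples outside the
  -- fibre are irrelevant
  BVal : Set₁
  BVal = B → (m : ℕ) → ℕ → (Fin m → T) → Set

  Invariant : BVal → Set
  Invariant I = ∀ {w w'} → w ≈ w' → ∀ m k as → I w m k as → I w' m k as

  -- truth at w under an assignment g (assigning elements of π⁻¹ w to the
  -- free variables); this is the paper's w ⊨ ψ[g(x⃗)/x⃗]
  bsat : BVal → B → (ℕ → T) → FForm → Set
  bsat I w g (atom m k xs) = I w m k (λ i → g (xs i))
  bsat I w g (fneg ψ)      = ¬ bsat I w g ψ
  bsat I w g (for ψ χ)     = bsat I w g ψ ⊎ bsat I w g χ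
  bsat I w g (fex z ψ)     = Σ T (λ a → (π a ≈ w) × bsat I w (upd g z a) ψ)
  bsat I w g (fdia ψ)      =
    Σ B (λ v → R₀ w v × Σ (ℕ → T) (λ h →
        (∀ y → Free y ψ → Rt (g y) (h y) × (π (h y) ≈ v))
      × (∀ y y' → Free y ψ → Free y' ψ → g y ≡ g y' → h y ≡ h y')
      × bsat I v h ψ))

  -- valid: universal closure true at every w under every valuation
  ValidB : FForm → Set₁
  ValidB ψ = (I : BVal) → Invariant I → (w : B) → (g : ℕ → T) →
             (∀ y → Free y ψ → π (g y) ≈ w) → bsat I w g ψ

-- The bundle 𝓑(𝔉) = ((X,R), π, (X/E, R₀)), X/E represented as X with ≈ = E,
-- π the quotient map, [x] R₀ [y] iff x R z and z E y for some z.

𝓑 : MKFrame → Bundle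
𝓑 F = record
  { T    = X
  ; Rt   = R
  ; B    = X
  ; _≈_  = E
  ; ≈-eq = E-equiv
  ; R₀   = λ x y → Σ X (λ z → R x z × E z y)
  ; π    = λ x → x
  }
  where open MKFrame F

xv : ℕ
xv = 0

tr : Form → FForm
tr (var n)  = atom 1 n (λ _ → xv)
tr (neg φ)  = fneg (tr φ)
tr (or φ ψ) = for (tr φ) (tr ψ)
tr (dia φ)  = fdia (tr φ)
tr (ex φ)   = fex xv (tr φ)

{-# OPTIONS --safe #-}
module Submission where

open import Defs
open import Function.Base using (_∘_)
open import Function.Bundles using (_⇔_; mk⇔; module Equivalence)
open import Function.Related.TypeIsomorphisms using (¬-cong-⇔)
open import Data.Nat using (ℕ; zero; suc)
open import Data.Fin using (Fin)
open import Data.Product using (Σ; _×_; _,_)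
open import Data.Sum using (inj₁; inj₂)
open import Data.Sum.Function.Propositional using (_⊎-⇔_)
open import Data.Empty using (⊥; ⊥-elim)
open import Relation.Nullary using (Dec; yes; no)
open import Relation.Binary.PropositionalEquality using (_≡_; refl; sym; subst)
open import Relation.Binary.Structures using (IsEquivalence)

open Equivalence using (to; from)

-- The translation of φ has at most x free, so an assignment in the fibre over w
-- amounts to a single point of the E-class w, and tr φ holds there in 𝓑(𝔉) iff φ
-- holds at that point of 𝔉.  The only real case is ◇: by the MK condition an
-- R₀-step out of the class of a point is matched by an R-step out of the point itself.

Free-tr⇒≡xv : ∀ φ {y} → Free y (tr φ) → y ≡ xv
Free-tr⇒≡xv (var n)  (_ , xv≡y)  = sym xv≡y
Free-tr⇒≡xv (neg φ)  free        = Free-tr⇒≡xv φ free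
Free-tr⇒≡xv (or φ ψ) (inj₁ free) = Free-tr⇒≡xv φ free
Free-tr⇒≡xv (or φ ψ) (inj₂ free) = Free-tr⇒≡xv ψ free
Free-tr⇒≡xv (dia φ)  free        = Free-tr⇒≡xv φ free
Free-tr⇒≡xv (ex φ)   (y≢xv , free) = ⊥-elim (y≢xv (Free-tr⇒≡xv φ free))

Free-xv-tr? : ∀ φ → Dec (Free xv (tr φ))
Free-xv-tr? (var n)  = yes (Fin.zero , refl)
Free-xv-tr? (neg φ)  = Free-xv-tr? φ
Free-xv-tr? (or φ ψ) with Free-xv-tr? φ | Free-xv-tr? ψ
... | yes free | _        = yes (inj₁ free)
... | no _     | yes free = yes (inj₂ free)
... | no ¬free | no ¬free′ = no λ { (inj₁ free) → ¬free free ; (inj₂ free) → ¬free′ free }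
Free-xv-tr? (dia φ)  = Free-xv-tr? φ
Free-xv-tr? (ex φ)   = no λ { (xv≢xv , _) → xv≢xv refl }

module _ (𝔅 : Bundle) (I : BVal 𝔅) where
  open Bundle 𝔅

  bsat-tr-cong : ∀ φ w {g g′ : ℕ → T} → (Free xv (tr φ) → g xv ≡ g′ xv) →
                 bsat 𝔅 I w g (tr φ) → bsat 𝔅 I w g′ (tr φ)
  bsat-tr-cong (var n)  w g≡g′ s = subst (λ a → I w 1 n (λ _ → a)) (g≡g′ (Fin.zero , refl)) s
  bsat-tr-cong (neg φ)  w g≡g′ ¬s s′ = ¬s (bsat-tr-cong φ w (sym ∘ g≡g′) s′)
  bsat-tr-cong (or φ ψ) w g≡g′ (inj₁ s) = inj₁ (bsat-tr-cong φ w (g≡g′ ∘ inj₁) s)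
  bsat-tr-cong (or φ ψ) w g≡g′ (inj₂ s) = inj₂ (bsat-tr-cong ψ w (g≡g′ ∘ inj₂) s)
  bsat-tr-cong (dia φ)  w {g} {g′} g≡g′ (v , wR₀v , h , h-succ , _ , s) =
    v , wR₀v , h , h-succ′ , h-inj , s
    where
      h-succ′ : ∀ y → Free y (tr φ) → Rt (g′ y) (h y) × (π (h y) ≈ v)
      h-succ′ y free with refl ← Free-tr⇒≡xv φ free =
        let gRh , h∈v = h-succ xv free in subst (λ a → Rt a (h xv)) (g≡g′ free) gRh , h∈v
      h-inj : ∀ y y′ → Free y (tr φ) → Free y′ (tr φ) → g′ y ≡ g′ y′ → h y ≡ h y′
      h-inj y y′ free free′ _ with refl ← Free-tr⇒≡xv φ free | refl ← Free-tr⇒≡xv φ free′ = refl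
  bsat-tr-cong (ex φ)   w g≡g′ (a , a∈w , s) = a , a∈w , bsat-tr-cong φ w (λ _ → refl) s

module _ (F : MKFrame) where
  open MKFrame F
  open IsEquivalence E-equiv renaming (refl to E-refl; sym to E-sym; trans to E-trans)

  R₀⇒R : ∀ {x w v} → E x w → Bundle.R₀ (𝓑 F) w v → Σ X (λ u → R x u × E u v)
  R₀⇒R x~w (z , wRz , z~v) with u , xRu , u~z ← mk x~w wRz = u , xRu , E-trans u~z z~v

  toVal : BVal (𝓑 F) → Val F
  toVal I n x = I x 1 n (λ _ → x)

  -- Only the unary predicates p_n^* occur in translations; nullary ones are interpreted as empty.
  fromVal : Val F → BVal (𝓑 F)
  fromVal V _ zero    k as = ⊥
  fromVal V _ (suc m) k as = V k (as Fin.zero)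

  fromVal-invariant : (V : Val F) → Invariant (𝓑 F) (fromVal V)
  fromVal-invariant V _ zero    k as p = p
  fromVal-invariant V _ (suc m) k as p = p

  module _ (I : BVal (𝓑 F)) (I-inv : Invariant (𝓑 F) I) where

    bsat-tr⇔sat : ∀ φ {w} (g : ℕ → X) → E (g xv) w → bsat (𝓑 F) I w g (tr φ) ⇔ sat F (toVal I) (g xv) φ
    bsat-tr⇔sat (var n)  g x~w = mk⇔ (I-inv (E-sym x~w) 1 n _) (I-inv x~w 1 n _)
    bsat-tr⇔sat (neg φ)  g x~w = ¬-cong-⇔ (bsat-tr⇔sat φ g x~w)
    bsat-tr⇔sat (or φ ψ) g x~w = bsat-tr⇔sat φ g x~w ⊎-⇔ bsat-tr⇔sat ψ g x~w
    bsat-tr⇔sat (dia φ) {w} g x~w = mk⇔ dia-to dia-from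
      where
        dia-to : bsat (𝓑 F) I w g (tr (dia φ)) → sat F (toVal I) (g xv) (dia φ)
        dia-to (v , wR₀v , h , h-succ , _ , s) with Free-xv-tr? φ
        ... | yes free with xRh , h~v ← h-succ xv free =
          h xv , xRh , to (bsat-tr⇔sat φ h h~v) s
        ... | no closed with u , xRu , u~v ← R₀⇒R x~w wR₀v =
          u , xRu , to (bsat-tr⇔sat φ (λ _ → u) u~v) (bsat-tr-cong (𝓑 F) I φ v (⊥-elim ∘ closed) s)
        dia-from : sat F (toVal I) (g xv) (dia φ) → bsat (𝓑 F) I w g (tr (dia φ))
        dia-from (y , xRy , s) =
          y , mk (E-sym x~w) xRy , (λ _ → y) , succ , (λ _ _ _ _ _ → refl) ,
          from (bsat-tr⇔sat φ (λ _ → y) E-refl) s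
          where
            succ : ∀ y′ → Free y′ (tr φ) → R (g y′) y × E y y
            succ y′ free with refl ← Free-tr⇒≡xv φ free = xRy , E-refl
    bsat-tr⇔sat (ex φ) g x~w = mk⇔
      (λ (a , a~w , s) → a , E-trans x~w (E-sym a~w) , to (bsat-tr⇔sat φ (upd g xv a) a~w) s)
      (λ (y , x~y , s) → let y~w = E-trans (E-sym x~y) x~w in
                         y , y~w , from (bsat-tr⇔sat φ (upd g xv y) y~w) s)

  validB-tr-intro : ∀ φ →
    (∀ I → Invariant (𝓑 F) I → ∀ {w} (g : ℕ → X) → E (g xv) w → bsat (𝓑 F) I w g (tr φ)) →
    ValidB (𝓑 F) (tr φ)
  validB-tr-intro φ holds I I-inv w g g-in-fibre with Free-xv-tr? φ
  ... | yes free   = holds I I-inv g (g-in-fibre xv free)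
  ... | no closed  = bsat-tr-cong (𝓑 F) I φ w (⊥-elim ∘ closed) (holds I I-inv (λ _ → w) E-refl)

theorem5p3 : (F : MKFrame) → (φ : Form) → ValidF F φ ⇔ ValidB (𝓑 F) (tr φ)
theorem5p3 F φ = mk⇔ validF⇒validB validB⇒validF
  where
    open MKFrame F
    open IsEquivalence E-equiv using () renaming (refl to E-refl)

    validF⇒validB : ValidF F φ → ValidB (𝓑 F) (tr φ)
    validF⇒validB valid = validB-tr-intro F φ λ I I-inv g x~w →
      from (bsat-tr⇔sat F I I-inv φ g x~w) (valid (toVal F I) (g xv))

    validB⇒validF : ValidB (𝓑 F) (tr φ) → ValidF F φ
    validB⇒validF valid V x =
      to (bsat-tr⇔sat F (fromVal F V) (fromVal-invariant F V) φ (λ _ → x) E-refl)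
         (valid (fromVal F V) (fromVal-invariant F V) x (λ _ → x) (λ _ _ → E-refl))
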